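{- Let $M$ be a fixed deterministic Turing machine and let $D$, $F$, $B_T$ be as defined in the context. Then no $p \in \bigcup_{T \in \mathbb{N}} B_T$ satisfies $F(p) = p$, whereas the directed supremum $p_\omega = \bigsqcup_{n \in \mathbb{N}} p_n$, where $p_0 = \bot$ and $p_{n+1} = F(p_n)$, equals $\operatorname{lfp}(F)$ and thus satisfies $F(p_\omega) = p_\omega$, while $p_\omega \notin \bigcup_{T\in\mathbb{N}} B_T$.
   Context: Let $D$ be the set of partial functions $p : \mathbb{N} \to \{0,1,\bot\}$ (where $p(k)=\bot$ means $p$ is undefined at $k$) satisfying: $p(k) = 1$ implies $p(k') = 1$ for all $k' \ge k$, ordered by $p \sqsubseteq q$ iff $q(x) = p(x)$ whenever $p(x) \neq \bot$; $\bigsqcup$ denotes least upper bound, $\bot$ also denotes the everywhere-undefined function, and $\operatorname{lfp}(F)$ is the least fixed point of $F$. Define $F : D \to D$ by: $F(p)(0) = 1$ if $M$ halts at or before step $0$, and $F(p)(0) = 0$ otherwise; and for $k \ge 0$, $F(p)(k+1) = \bot$ if $p(k) = \bot$; $F(p)(k+1) = 1$ if $p(k) = 1$; $F(p)(k+1) = 1$ if $p(k) = 0$ and $M$ halts at exactly step $k+1$; $F(p)(k+1) = 0$ if $p(k) = 0$ and $M$ does not halt at step $k+1$. For $T \in \mathbb{N}$, $B_T$ denotes the class of finite halting observations computable by a machine with time bound $T$, namely the partial functions defined on $\{0, 1, \ldots, T-1\}$ and undefined ($=\bot$) at every $k \ge T$. -}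

module Defs where

open import Data.Nat using (ℕ; zero; suc; _≤_; _<_)
open import Data.Integer using (ℤ; +_) renaming (suc to sucℤ; pred to predℤ)
open import Data.Fin using (Fin)
open import Data.Bool using (Bool; true; false; if_then_else_; not; _∧_)
open import Data.Maybe using (Maybe; just; nothing)
open import Data.Product using (Σ; _×_; _,_)
open import Relation.Binary.PropositionalEquality using (_≡_; _≢_)
open import Relation.Nullary using (¬_)

-- Deterministic Turing machines (one two-way infinite tape indexed by ℤ).
-- The machine halts when the transition function is undefined (nothing).

data Move : Set where
  left right : Move

record TM : Set where
  field
    nStates  : ℕ
    nSymbols : ℕ
    δ        : Fin nStates → Fin nSymbols → Maybe (Fin nStates × Fin nSymbols × Move)
    q₀       : Fin nStates
    tape₀    : ℤ → Fin nSymbols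
    head₀    : ℤ

module _ (M : TM) where
  open TM M

  record Config : Set where
    constructor cfg
    field
      state : Fin nStates
      tape  : ℤ → Fin nSymbols
      head  : ℤ

  open Config

  move : Move → ℤ → ℤ
  move left  h = predℤ h
  move right h = sucℤ h

  write : (ℤ → Fin nSymbols) → ℤ → Fin nSymbols → ℤ → Fin nSymbols
  write t h s i with i Data.Integer.≟ h
  ... | Relation.Nullary.yes _ = s
  ... | Relation.Nullary.no  _ = t i

  step : Config → Config
  step c with δ (state c) (tape c (head c))
  ... | nothing = c
  ... | just (q , s , m) = cfg q (write (tape c) (head c) s) (move m (head c))

  halted : Config → Bool
  halted c with δ (state c) (tape c (head c))
  ... | nothing = true
  ... | just _  = false

  conf : ℕ → Config
  conf zero    = cfg q₀ tape₀ head₀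
  conf (suc k) = step (conf k)

  haltsBy : ℕ → Bool
  haltsBy k = halted (conf k)

  haltsAt : ℕ → Bool
  haltsAt zero    = haltsBy zero
  haltsAt (suc k) = haltsBy (suc k) ∧ not (haltsBy k)

data Val : Set where
  v0 v1 undef : Val

Obs : Set
Obs = ℕ → Val

InD : Obs → Set
InD p = ∀ k k' → k ≤ k' → p k ≡ v1 → p k' ≡ v1

_⊑_ : Obs → Obs → Set
p ⊑ q = ∀ x → p x ≢ undef → q x ≡ p x

⊥ₒ : Obs
⊥ₒ _ = undef

F : TM → Obs → Obs
F M p zero = if haltsBy M zero then v1 else v0
F M p (suc k) with p k
... | undef = undef
... | v1    = v1
... | v0    = if haltsAt M (suc k) then v1 else v0

chain : TM → ℕ → Obs
chain M zero    = ⊥ₒ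
chain M (suc n) = F M (chain M n)

IsFixed : (Obs → Obs) → Obs → Set
IsFixed G p = ∀ k → G p k ≡ p k

IsLfp : (Obs → Obs) → Obs → Set
IsLfp G q = InD q × IsFixed G q × (∀ r → InD r → IsFixed G r → q ⊑ r)

IsLub : (ℕ → Obs) → Obs → Set
IsLub c q = InD q × (∀ n → c n ⊑ q) × (∀ r → InD r → (∀ n → c n ⊑ r) → q ⊑ r)

InB : ℕ → Obs → Set
InB T p = (∀ k → k < T → p k ≢ undef) × (∀ k → T ≤ k → p k ≡ undef)

{-# OPTIONS --safe #-}
module Submission where

-- F p (k+1) depends only on p k, and F p 0 is always defined. Hence, by induction on k,
-- every fixed point of F is defined everywhere (so lies in no B_T) and any two fixed
-- points agree: F has exactly one fixed point. The Kleene chain is ⊥ below the diagonal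
-- (p_n k = ⊥ for n ≤ k) and constant above it (p_n k = p_{k+1} k for n > k), so its
-- supremum is p_ω k = p_{k+1} k, which is that unique fixed point.

open import Defs
open import Data.Nat using (ℕ; zero; suc; _≤_; _≤′_; ≤′-refl; ≤′-step; _≤?_; s≤s)
open import Data.Nat.Properties using (≤-refl; ≤⇒≤′; ≰⇒>)
open import Data.Product using (Σ; _×_; _,_)
open import Data.Bool using (true; false; if_then_else_)
open import Function using (_∘_)
open import Relation.Nullary using (¬_; yes; no; contradiction)
open import Relation.Binary.PropositionalEquality

module _ (M : TM) where

  F-cong-suc : ∀ p q k → p k ≡ q k → F M p (suc k) ≡ F M q (suc k)
  F-cong-suc p q k eq with p k | q k
  F-cong-suc p q k refl | _ | _ = refl

  F-cong : ∀ {p q} → p ≗ q → F M p ≗ F M q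
  F-cong         eq zero    = refl
  F-cong {p} {q} eq (suc k) = F-cong-suc p q k (eq k)

  if-defined : ∀ b → (if b then v1 else v0) ≢ undef
  if-defined true  ()
  if-defined false ()

  F-zero-defined : ∀ p → F M p zero ≢ undef
  F-zero-defined p = if-defined (haltsBy M zero)

  F-suc-defined : ∀ p k → p k ≢ undef → F M p (suc k) ≢ undef
  F-suc-defined p k defined with p k
  ... | undef = contradiction refl defined
  ... | v1    = λ ()
  ... | v0    = if-defined (haltsAt M (suc k))

  F-suc-v1 : ∀ p k → p k ≡ v1 → F M p (suc k) ≡ v1
  F-suc-v1 p k eq = F-cong-suc p (λ _ → v1) k eq

  fixed-resp-≗ : ∀ {p q} → p ≗ q → IsFixed (F M) p → IsFixed (F M) q
  fixed-resp-≗ {p} {q} p≗q fixed k = begin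
    F M q k  ≡⟨ F-cong (sym ∘ p≗q) k ⟩
    F M p k  ≡⟨ fixed k ⟩
    p k      ≡⟨ p≗q k ⟩
    q k      ∎
    where open ≡-Reasoning

  fixed⇒total : ∀ {p} → IsFixed (F M) p → ∀ k → p k ≢ undef
  fixed⇒total {p} fixed zero    = F-zero-defined p ∘ trans (fixed zero)
  fixed⇒total {p} fixed (suc k) = F-suc-defined p k (fixed⇒total fixed k) ∘ trans (fixed (suc k))

  fixed⇒¬InB : ∀ {p} T → IsFixed (F M) p → ¬ InB T p
  fixed⇒¬InB T fixed (_ , undefinedFromT) = fixed⇒total fixed T (undefinedFromT T ≤-refl)

  fixed⇒InD : ∀ {p} → IsFixed (F M) p → InD p
  fixed⇒InD {p} fixed k k' k≤k' pk≡v1 = go (≤⇒≤′ k≤k')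
    where
    go : ∀ {n} → k ≤′ n → p n ≡ v1
    go ≤′-refl                = pk≡v1
    go (≤′-step {n = n} k≤′n) = trans (sym (fixed (suc n))) (F-suc-v1 p n (go k≤′n))

  fixed-unique : ∀ {p q} → IsFixed (F M) p → IsFixed (F M) q → p ≗ q
  fixed-unique p-fixed q-fixed zero = trans (sym (p-fixed zero)) (q-fixed zero)
  fixed-unique {p} {q} p-fixed q-fixed (suc k) = begin
    p (suc k)        ≡⟨ p-fixed (suc k) ⟨
    F M p (suc k)    ≡⟨ F-cong-suc p q k (fixed-unique p-fixed q-fixed k) ⟩
    F M q (suc k)    ≡⟨ q-fixed (suc k) ⟩
    q (suc k)        ∎
    where open ≡-Reasoning

  pω : Obs
  pω k = chain M (suc k) k

  pω-fixed : IsFixed (F M) pω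
  pω-fixed zero    = refl
  pω-fixed (suc k) = refl

  chain-undef : ∀ {n k} → n ≤ k → chain M n k ≡ undef
  chain-undef {zero}          _         = refl
  chain-undef {suc n} {suc k} (s≤s n≤k) = F-cong-suc (chain M n) ⊥ₒ k (chain-undef n≤k)

  chain-stable : ∀ {n k} → k ≤ n → chain M (suc n) k ≡ pω k
  chain-stable {_}     {zero}  _         = refl
  chain-stable {suc n} {suc k} (s≤s k≤n) = F-cong-suc (chain M (suc n)) (chain M (suc k)) k (chain-stable k≤n)

  chain⊑pω : ∀ n → chain M n ⊑ pω
  chain⊑pω n k defined with n ≤? k
  ... | yes n≤k = contradiction (chain-undef n≤k) defined
  ... | no  n≰k with ≰⇒> n≰k
  ...   | s≤s k≤n = sym (chain-stable k≤n)

  pω-least : ∀ r → (∀ n → chain M n ⊑ r) → pω ⊑ r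
  pω-least r chain⊑r k _ = chain⊑r (suc k) k (fixed⇒total pω-fixed k)

  pω-isLub : IsLub (chain M) pω
  pω-isLub = fixed⇒InD pω-fixed , chain⊑pω , λ r _ → pω-least r

  isLub⇒≗pω : ∀ {q} → IsLub (chain M) q → q ≗ pω
  isLub⇒≗pω {q} (_ , chain⊑q , _) k = pω-least q chain⊑q k (fixed⇒total pω-fixed k)

mainTheorem5 : (M : TM) →
    (∀ (T : ℕ) (p : Obs) → InD p → InB T p → ¬ IsFixed (F M) p)
    × Σ Obs (IsLub (chain M))
    × (∀ (q : Obs) → IsLub (chain M) q →
         IsLfp (F M) q × IsFixed (F M) q × (∀ (T : ℕ) → ¬ InB T q))
mainTheorem5 M =
    (λ T p _ p∈B p-fixed → fixed⇒¬InB M T p-fixed p∈B)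
  , (pω M , pω-isLub M)
  , λ q q-isLub →
      let q-fixed = fixed-resp-≗ M (sym ∘ isLub⇒≗pω M q-isLub) (pω-fixed M)
      in  ( fixed⇒InD M q-fixed
          , q-fixed
          , λ r _ r-fixed k _ → fixed-unique M r-fixed q-fixed k )
        , q-fixed
        , λ T → fixed⇒¬InB M T q-fixed
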